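{- There exist infinitely many $n$ and, for each of them, a threshold network $\mathcal{T}_n$ on a signed graph with $n$ vertices whose loopless part is the cycle $C_n$ (self-loops allowed), together with a periodic update mode $\mu_n$, such that the dynamics $x\mapsto F_{\mu_n}(x)$ of $\mathcal{T}_n$ has an attractor of period $p(n)$ that is super-polynomial in $n$ (i.e. for every polynomial $q$, $p(n)>q(n)$ for all sufficiently large $n$ in this family).
   Context: A signed graph has vertex set $V$, undirected edges between distinct vertices, self-loops, and a sign in $\{ -1,+1\}$ on every edge and loop. Its interaction matrix $W=(w_{ij})$ is symmetric with $w_{ij}$ the sign of edge $\{i,j\}$ (or of the loop at $i$ when $i=j$) and $0$ if absent. A threshold network with thresholds $b\in\mathbb{Z}^V$ has local functions $f_i(x)=1$ if $\sum_{j}w_{ij}x_j-b_i>0$, $f_i(x)=x_i$ if it is $0$, $f_i(x)=-1$ otherwise, for $x\in\{ -1,1\}^V$. For $I\subseteq V$, $f_I(x)_i=f_i(x)$ if $i\in I$, else $x_i$. A periodic update mode is a finite sequence $\mu=(I_1,\ldots,I_\ell)$ of subsets of $V$, with global map $F_\mu=f_{I_\ell}\circ\cdots\circ f_{I_1}$. An attractor of period $p$ is a configuration $x$ with $F_\mu^p(x)=x$ and $p\ge1$ minimal. -}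

module Defs where

open import Data.Nat as ℕ using (ℕ; zero; suc; _≤_; _<_)
open import Data.Integer as ℤ using (ℤ; +_; -[1+_]; 0ℤ; 1ℤ; -1ℤ)
open import Data.Bool using (Bool; true; false)
open import Data.Fin using (Fin; toℕ)
open import Data.Fin.Subset using (Subset; Side; inside; outside)
open import Data.Vec using (Vec; lookup; tabulate)
open import Data.List using (List; []; _∷_)
open import Data.Product using (_×_; Σ-syntax)
open import Data.Sum using (_⊎_)
open import Relation.Binary.PropositionalEquality using (_≡_; _≢_)
open import Relation.Nullary using (¬_)

spin : Bool → ℤ
spin true  = 1ℤ
spin false = -1ℤ

Config : ℕ → Set
Config n = Vec Bool n

Σℤ : (n : ℕ) → (Fin n → ℤ) → ℤ
Σℤ zero    f = 0ℤ
Σℤ (suc n) f = f Fin.zero ℤ.+ Σℤ n (λ i → f (Fin.suc i))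
  where import Data.Fin as Fin

record ThresholdNetwork (n : ℕ) : Set where
  field
    W : Fin n → Fin n → ℤ
    b : Fin n → ℤ
open ThresholdNetwork public

CycNext : (n : ℕ) → Fin n → Fin n → Set
CycNext n i j = (suc (toℕ i) ≡ toℕ j) ⊎ ((suc (toℕ i) ≡ n) × (toℕ j ≡ 0))

CycAdj : (n : ℕ) → Fin n → Fin n → Set
CycAdj n i j = CycNext n i j ⊎ CycNext n j i

IsSignedCycleWithLoops : (n : ℕ) → (Fin n → Fin n → ℤ) → Set
IsSignedCycleWithLoops n W =
  (3 ≤ n) ×
  (∀ i j → W i j ≡ W j i) ×
  (∀ i j → (W i j ≡ 0ℤ) ⊎ (W i j ≡ 1ℤ) ⊎ (W i j ≡ -1ℤ)) ×
  (∀ i j → CycAdj n i j → W i j ≢ 0ℤ) ×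
  (∀ i j → i ≢ j → ¬ CycAdj n i j → W i j ≡ 0ℤ)

step : ℤ → Bool → Bool
step (+ zero)  xi = xi
step (+ suc _) xi = true
step -[1+ _ ]  xi = false

localF : ∀ {n} → ThresholdNetwork n → Fin n → Config n → Bool
localF {n} T i x =
  step (Σℤ n (λ j → W T i j ℤ.* spin (lookup x j)) ℤ.- b T i) (lookup x i)

updateSet : ∀ {n} → ThresholdNetwork n → Subset n → Config n → Config n
updateSet T I x = tabulate λ i → choose (lookup I i) i
  where
  choose : Side → _ → Bool
  choose inside  i = localF T i x
  choose outside i = lookup x i

UpdateMode : ℕ → Set
UpdateMode n = List (Subset n)

globalMap : ∀ {n} → ThresholdNetwork n → UpdateMode n → Config n → Config n
globalMap T []      x = x
globalMap T (I ∷ μ) x = globalMap T μ (updateSet T I x)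

iterate : ∀ {A : Set} → (A → A) → ℕ → A → A
iterate f zero    x = x
iterate f (suc k) x = f (iterate f k x)

IsAttractorOfPeriod : ∀ {A : Set} → (A → A) → A → ℕ → Set
IsAttractorOfPeriod F x p =
  (1 ≤ p) × (iterate F p x ≡ x) ×
  (∀ q → 1 ≤ q → q < p → iterate F q x ≢ x)

Poly : Set
Poly = List ℤ

evalPoly : Poly → ℤ → ℤ
evalPoly []       z = 0ℤ
evalPoly (c ∷ cs) z = c ℤ.+ z ℤ.* evalPoly cs z

-- Each block of the cycle consists of an on cell, L digit cells and an off cell. A digit
-- (self-loop -1, threshold 0) computes the majority of its left neighbour, its own negation
-- and its right neighbour, while the thresholds of on and off exceed their input range, so
-- these two cells are constant. Updating the vertices one at a time from right to left, each
-- digit sees the new value of its right neighbour; hence a block reading 1^c 0^(L-c) moves to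
-- 1^(c+1) 0^(L-c-1), and from c = L back to c = 0: it is a counter modulo L + 1, and the
-- configuration with all counters at 0 has period lcm (L_i + 1). Choosing L_j = j M for
-- j = 1, ..., k with M = k!, the moduli 1 + j M are pairwise coprime, so the period is at
-- least (M + 1)^k, while the cycle has fewer than (M + 1)^3 vertices.

module Submission where

open import Defs
open import Data.Bool using (Bool; true; false; not)
open import Data.Fin as Fin using (Fin; toℕ)
import Data.Fin.Properties as Finₚ
open import Data.Fin.Subset using (inside; outside; ⁅_⁆; _∈_; _∉_)
open import Data.Fin.Subset.Properties using (x∈⁅x⁆; x≢y⇒x∉⁅y⁆)
open import Data.Integer as ℤ using (ℤ; +_; -[1+_]; 0ℤ; 1ℤ; -1ℤ)
import Data.Integer.Properties as ℤₚ
open import Data.List as List using (List; []; _∷_)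
open import Data.Nat.ListAction using (product)
open import Data.List.Relation.Unary.All as All using (All; []; _∷_)
import Data.List.Relation.Unary.All.Properties as Allₚ
open import Data.List.Relation.Unary.AllPairs using (AllPairs; []; _∷_)
open import Data.Nat as ℕ using (ℕ; zero; suc; _≤_; _<_; z≤n; s≤s; _%_; _!; _^_)
import Data.Nat.Properties as ℕₚ
open import Data.Nat.DivMod using (%-distribˡ-+; m%n%n≡m%n; m%n<n; m≤n⇒m%n≡m; n%n≡0)
open import Data.Nat.Coprimality using (Coprime; coprime-divisor; coprime⇒gcd≡1)
open import Data.Nat.Divisibility
  using (_∣_; ∣-trans; 1∣_; ∣⇒≤; ∣1⇒≡1; 0∣⇒≡0; ∣m+n∣m⇒∣n; ∣n⇒∣m*n; m∣m*n; m≤n⇒m!∣n!; m%n≡0⇒n∣m; n∣m⇒m%n≡0)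
open import Data.Nat.Solver using (module +-*-Solver)
open import Data.Nat.GCD using (gcd)
open import Data.Nat.LCM using (lcm; lcm-least; m∣lcm[m,n]; n∣lcm[m,n]; gcd*lcm)
open import Data.Product using (Σ-syntax; ∃-syntax; _×_; _,_; proj₁; proj₂)
open import Data.Sum using (_⊎_; inj₁; inj₂)
open import Data.Vec using (Vec; []; _∷_; _++_; lookup; tabulate; replicate)
import Data.Vec.Properties as Vecₚ
open import Function using (_∘_)
open import Relation.Binary.Definitions using (tri<; tri≈; tri>)
open import Relation.Binary.PropositionalEquality
open import Relation.Nullary using (¬_; Dec; yes; no; contradiction)
open import Relation.Nullary.Decidable using (_⊎-dec_; _×-dec_)

data Cell : Set where
  digit on off : Cell

loop : Cell → ℤ
loop digit = -1ℤ
loop on    = 0ℤ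
loop off   = 0ℤ

threshold : Cell → ℤ
threshold digit = 0ℤ
threshold on    = -[1+ 4 ]
threshold off   = + 5

majority : Bool → Bool → Bool → Bool
majority true  true  _ = true
majority false false _ = false
majority _     _     r = r

rule : Cell → Bool → Bool → Bool → Bool
rule digit l s r = majority l (not s) r
rule on    _ _ _ = true
rule off   _ _ _ = false

at : ∀ {A : Set} {n} → A → Vec A n → ℕ → A
at d []       _       = d
at d (x ∷ xs) zero    = x
at d (x ∷ xs) (suc k) = at d xs k

bit : ∀ {n} → Config n → ℕ → Bool
bit = at false

cellAt : ∀ {n} → Vec Cell n → ℕ → Cell
cellAt = at digit

at-toℕ : ∀ {A : Set} {n} (d : A) (xs : Vec A n) (i : Fin n) → at d xs (toℕ i) ≡ lookup xs i
at-toℕ d (x ∷ xs) Fin.zero    = refl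
at-toℕ d (x ∷ xs) (Fin.suc i) = at-toℕ d xs i

lookup-ext : ∀ {A : Set} {n} {xs ys : Vec A n} → (∀ i → lookup xs i ≡ lookup ys i) → xs ≡ ys
lookup-ext {xs = xs} {ys} eq =
  trans (sym (Vecₚ.tabulate∘lookup xs)) (trans (Vecₚ.tabulate-cong eq) (Vecₚ.tabulate∘lookup ys))

-- CycAdj n i j is definitionally CycAdjℕ n (toℕ i) (toℕ j).

CycNextℕ : ℕ → ℕ → ℕ → Set
CycNextℕ n a b = (suc a ≡ b) ⊎ ((suc a ≡ n) × (b ≡ 0))

CycAdjℕ : ℕ → ℕ → ℕ → Set
CycAdjℕ n a b = CycNextℕ n a b ⊎ CycNextℕ n b a

cycNextℕ? : ∀ n a b → Dec (CycNextℕ n a b)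
cycNextℕ? n a b = (suc a ℕₚ.≟ b) ⊎-dec ((suc a ℕₚ.≟ n) ×-dec (b ℕₚ.≟ 0))

cycAdjℕ? : ∀ n a b → Dec (CycAdjℕ n a b)
cycAdjℕ? n a b = cycNextℕ? n a b ⊎-dec cycNextℕ? n b a

cycAdjℕ-sym : ∀ {n a b} → CycAdjℕ n a b → CycAdjℕ n b a
cycAdjℕ-sym (inj₁ p) = inj₂ p
cycAdjℕ-sym (inj₂ p) = inj₁ p

cycAdjℕ-irrefl : ∀ {n a} → 3 ≤ n → ¬ CycAdjℕ n a a
cycAdjℕ-irrefl 3≤n (inj₁ (inj₁ e))         = ℕₚ.1+n≢n e
cycAdjℕ-irrefl 3≤n (inj₁ (inj₂ (e , refl))) = ℕₚ.<⇒≢ (ℕₚ.≤-trans (s≤s (s≤s z≤n)) 3≤n) e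
cycAdjℕ-irrefl 3≤n (inj₂ (inj₁ e))         = ℕₚ.1+n≢n e
cycAdjℕ-irrefl 3≤n (inj₂ (inj₂ (e , refl))) = ℕₚ.<⇒≢ (ℕₚ.≤-trans (s≤s (s≤s z≤n)) 3≤n) e

weight : ℕ → Cell → ℕ → ℕ → ℤ
weight n c a b with a ℕₚ.≟ b | cycAdjℕ? n a b
... | yes _ | _     = loop c
... | no _  | yes _ = 1ℤ
... | no _  | no _  = 0ℤ

weight-loop : ∀ n c a → weight n c a a ≡ loop c
weight-loop n c a with a ℕₚ.≟ a
... | yes _  = refl
... | no a≢a = contradiction refl a≢a

weight-adjacent : ∀ n c {a b} → a ≢ b → CycAdjℕ n a b → weight n c a b ≡ 1ℤ
weight-adjacent n c {a} {b} a≢b adj with a ℕₚ.≟ b | cycAdjℕ? n a b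
... | yes a≡b | _      = contradiction a≡b a≢b
... | no _    | yes _  = refl
... | no _    | no ¬adj = contradiction adj ¬adj

weight-far : ∀ n c {a b} → a ≢ b → ¬ CycAdjℕ n a b → weight n c a b ≡ 0ℤ
weight-far n c {a} {b} a≢b ¬adj with a ℕₚ.≟ b | cycAdjℕ? n a b
... | yes a≡b | _      = contradiction a≡b a≢b
... | no _    | yes adj = contradiction adj ¬adj
... | no _    | no _   = refl

weight-signed : ∀ n c a b → (weight n c a b ≡ 0ℤ) ⊎ (weight n c a b ≡ 1ℤ) ⊎ (weight n c a b ≡ -1ℤ)
weight-signed n c a b with a ℕₚ.≟ b | cycAdjℕ? n a b
weight-signed n digit a b | yes _ | _ = inj₂ (inj₂ refl)
weight-signed n on    a b | yes _ | _ = inj₁ refl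
weight-signed n off   a b | yes _ | _ = inj₁ refl
... | no _ | yes _ = inj₂ (inj₁ refl)
... | no _ | no _  = inj₁ refl

network : ∀ {n} → Vec Cell n → ThresholdNetwork n
network {n} cs = record
  { W = λ i j → weight n (lookup cs i) (toℕ i) (toℕ j)
  ; b = threshold ∘ lookup cs
  }

network-isSignedCycle : ∀ {n} (cs : Vec Cell n) → 3 ≤ n → IsSignedCycleWithLoops n (W (network cs))
network-isSignedCycle {n} cs 3≤n = 3≤n , symmetric , signed , adjacent⇒≢0 , far⇒≡0
  where
  w = W (network cs)

  symmetric : ∀ i j → w i j ≡ w j i
  symmetric i j with i Fin.≟ j
  ... | yes refl = refl
  ... | no i≢j = byAdjacency (cycAdjℕ? n (toℕ i) (toℕ j))
    where
    ne = i≢j ∘ Finₚ.toℕ-injective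
    byAdjacency : Dec (CycAdjℕ n (toℕ i) (toℕ j)) → w i j ≡ w j i
    byAdjacency (yes adj) = trans (weight-adjacent n _ ne adj) (sym (weight-adjacent n _ (ne ∘ sym) (cycAdjℕ-sym adj)))
    byAdjacency (no ¬adj) = trans (weight-far n _ ne ¬adj) (sym (weight-far n _ (ne ∘ sym) (¬adj ∘ cycAdjℕ-sym)))

  signed : ∀ i j → (w i j ≡ 0ℤ) ⊎ (w i j ≡ 1ℤ) ⊎ (w i j ≡ -1ℤ)
  signed i j = weight-signed n (lookup cs i) (toℕ i) (toℕ j)

  adjacent⇒≢0 : ∀ i j → CycAdj n i j → w i j ≢ 0ℤ
  adjacent⇒≢0 i j adj w≡0 = 1ℤ≢0ℤ (trans (sym (weight-adjacent n (lookup cs i) ne adj)) w≡0)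
    where
    ne : toℕ i ≢ toℕ j
    ne e = cycAdjℕ-irrefl 3≤n (subst (CycAdjℕ n (toℕ i)) (sym e) adj)
    1ℤ≢0ℤ : 1ℤ ≢ 0ℤ
    1ℤ≢0ℤ ()

  far⇒≡0 : ∀ i j → i ≢ j → ¬ CycAdj n i j → w i j ≡ 0ℤ
  far⇒≡0 i j i≢j ¬adj = weight-far n (lookup cs i) (i≢j ∘ Finₚ.toℕ-injective) ¬adj

sumℕ : ℕ → (ℕ → ℤ) → ℤ
sumℕ zero    g = 0ℤ
sumℕ (suc n) g = g 0 ℤ.+ sumℕ n (g ∘ suc)

Σℤ-cong : ∀ n {f g : Fin n → ℤ} → (∀ i → f i ≡ g i) → Σℤ n f ≡ Σℤ n g
Σℤ-cong zero    f≗g = refl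
Σℤ-cong (suc n) f≗g = cong₂ ℤ._+_ (f≗g Fin.zero) (Σℤ-cong n (f≗g ∘ Fin.suc))

Σℤ-toℕ : ∀ n (g : ℕ → ℤ) → Σℤ n (g ∘ toℕ) ≡ sumℕ n g
Σℤ-toℕ zero    g = refl
Σℤ-toℕ (suc n) g = cong (λ x → g 0 ℤ.+ x) (Σℤ-toℕ n (g ∘ suc))

sumℕ-+ : ∀ m k (g : ℕ → ℤ) → sumℕ (m ℕ.+ k) g ≡ sumℕ m g ℤ.+ sumℕ k (λ b → g (m ℕ.+ b))
sumℕ-+ zero    k g = sym (ℤₚ.+-identityˡ _)
sumℕ-+ (suc m) k g = trans (cong (λ x → g 0 ℤ.+ x) (sumℕ-+ m k (g ∘ suc))) (sym (ℤₚ.+-assoc (g 0) _ _))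

sumℕ-zero : ∀ m (g : ℕ → ℤ) → (∀ b → b < m → g b ≡ 0ℤ) → sumℕ m g ≡ 0ℤ
sumℕ-zero zero    g g≡0 = refl
sumℕ-zero (suc m) g g≡0 = cong₂ ℤ._+_ (g≡0 0 (s≤s z≤n)) (sumℕ-zero m (g ∘ suc) (λ b b<m → g≡0 (suc b) (s≤s b<m)))

Outside : ℕ → ℕ → Set
Outside a b = b < a ⊎ suc (suc a) < b

outside⇒≢ : ∀ {a b} k → k ≤ 2 → Outside a b → b ≢ k ℕ.+ a
outside⇒≢ {a} k k≤2 (inj₁ b<a)   refl = ℕₚ.<⇒≱ b<a (ℕₚ.m≤n+m a k)
outside⇒≢ {a} k k≤2 (inj₂ 2+a<b) refl = ℕₚ.<⇒≱ 2+a<b (ℕₚ.+-monoˡ-≤ a k≤2)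

sumℕ-window : ∀ {n} a (g : ℕ → ℤ) → suc (suc a) < n → (∀ b → Outside a b → g b ≡ 0ℤ) →
  sumℕ n g ≡ g a ℤ.+ (g (suc a) ℤ.+ g (suc (suc a)))
sumℕ-window {n} a g 2+a<n g≡0 = begin
    sumℕ n g
  ≡⟨ cong (λ m → sumℕ m g) (sym a+[3+r]≡n) ⟩
    sumℕ (a ℕ.+ (3 ℕ.+ r)) g
  ≡⟨ sumℕ-+ a (3 ℕ.+ r) g ⟩
    sumℕ a g ℤ.+ (g (a ℕ.+ 0) ℤ.+ (g (a ℕ.+ 1) ℤ.+ (g (a ℕ.+ 2) ℤ.+ sumℕ r (λ b → g (a ℕ.+ (3 ℕ.+ b))))))
  ≡⟨ cong₂ ℤ._+_ before (cong₂ ℤ._+_ (cong g (ℕₚ.+-comm a 0))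
                           (cong₂ ℤ._+_ (cong g (ℕₚ.+-comm a 1))
                             (cong₂ ℤ._+_ (cong g (ℕₚ.+-comm a 2)) after))) ⟩
    0ℤ ℤ.+ (g a ℤ.+ (g (suc a) ℤ.+ (g (suc (suc a)) ℤ.+ 0ℤ)))
  ≡⟨ ℤₚ.+-identityˡ _ ⟩
    g a ℤ.+ (g (suc a) ℤ.+ (g (suc (suc a)) ℤ.+ 0ℤ))
  ≡⟨ cong (λ x → g a ℤ.+ (g (suc a) ℤ.+ x)) (ℤₚ.+-identityʳ _) ⟩
    g a ℤ.+ (g (suc a) ℤ.+ g (suc (suc a))) ∎
  where
  open ≡-Reasoning
  split = ℕₚ.m≤n⇒∃[o]m+o≡n (subst (_≤ n) (ℕₚ.+-comm 3 a) 2+a<n)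
  r = proj₁ split
  a+[3+r]≡n : a ℕ.+ (3 ℕ.+ r) ≡ n
  a+[3+r]≡n = trans (sym (ℕₚ.+-assoc a 3 r)) (proj₂ split)
  before : sumℕ a g ≡ 0ℤ
  before = sumℕ-zero a g (λ b b<a → g≡0 b (inj₁ b<a))
  after : sumℕ r (λ b → g (a ℕ.+ (3 ℕ.+ b))) ≡ 0ℤ
  after = sumℕ-zero r _ (λ b _ → g≡0 _ (inj₂ (subst (_≤ a ℕ.+ (3 ℕ.+ b)) (ℕₚ.+-comm a 3) (ℕₚ.+-monoʳ-≤ a (ℕₚ.m≤m+n 3 b)))))

weight-outside : ∀ {n} c {a b} → suc (suc a) < n → Outside a b → weight n c (suc a) b ≡ 0ℤ
weight-outside {n} c {a} {b} 2+a<n out = weight-far n c (outside⇒≢ 1 (s≤s z≤n) out ∘ sym) ¬adj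
  where
  ¬adj : ¬ CycAdjℕ n (suc a) b
  ¬adj (inj₁ (inj₁ e))       = outside⇒≢ 2 ℕₚ.≤-refl out (sym e)
  ¬adj (inj₁ (inj₂ (e , _))) = ℕₚ.<⇒≢ 2+a<n e
  ¬adj (inj₂ (inj₁ e))       = outside⇒≢ 0 z≤n out (ℕₚ.suc-injective e)
  ¬adj (inj₂ (inj₂ (_ , ())))

input-interior : ∀ {n} c (z : Config n) {a} → suc (suc a) < n →
  Σℤ n (λ j → weight n c (suc a) (toℕ j) ℤ.* spin (lookup z j))
    ≡ spin (bit z a) ℤ.+ (loop c ℤ.* spin (bit z (suc a)) ℤ.+ spin (bit z (suc (suc a))))
input-interior {n} c z {a} 2+a<n = begin
    Σℤ n (λ j → weight n c (suc a) (toℕ j) ℤ.* spin (lookup z j))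
  ≡⟨ Σℤ-cong n (λ j → cong (λ x → weight n c (suc a) (toℕ j) ℤ.* spin x) (sym (at-toℕ false z j))) ⟩
    Σℤ n (g ∘ toℕ)
  ≡⟨ Σℤ-toℕ n g ⟩
    sumℕ n g
  ≡⟨ sumℕ-window a g 2+a<n (λ b out → cong (ℤ._* spin (bit z b)) (weight-outside c 2+a<n out)) ⟩
    g a ℤ.+ (g (suc a) ℤ.+ g (suc (suc a)))
  ≡⟨ cong₂ ℤ._+_ (neighbour ℕₚ.1+n≢n (inj₂ (inj₁ refl)))
       (cong₂ ℤ._+_ (cong (ℤ._* spin (bit z (suc a))) (weight-loop n c (suc a)))
                    (neighbour (ℕₚ.1+n≢n ∘ sym) (inj₁ (inj₁ refl)))) ⟩
    spin (bit z a) ℤ.+ (loop c ℤ.* spin (bit z (suc a)) ℤ.+ spin (bit z (suc (suc a)))) ∎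
  where
  open ≡-Reasoning
  g : ℕ → ℤ
  g b = weight n c (suc a) b ℤ.* spin (bit z b)
  neighbour : ∀ {b} → suc a ≢ b → CycAdjℕ n (suc a) b → g b ≡ spin (bit z b)
  neighbour ne adj = trans (cong (ℤ._* spin (bit z _)) (weight-adjacent n c ne adj)) (ℤₚ.*-identityˡ _)

step-rule : ∀ c l s r → step (spin l ℤ.+ (loop c ℤ.* spin s ℤ.+ spin r) ℤ.- threshold c) s ≡ rule c l s r
step-rule digit true  true  true  = refl
step-rule digit true  true  false = refl
step-rule digit true  false true  = refl
step-rule digit true  false false = refl
step-rule digit false true  true  = refl
step-rule digit false true  false = refl
step-rule digit false false true  = refl
step-rule digit false false false = refl
step-rule on    true  true  true  = refl
step-rule on    true  true  false = refl
step-rule on    true  false true  = refl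
step-rule on    true  false false = refl
step-rule on    false true  true  = refl
step-rule on    false true  false = refl
step-rule on    false false true  = refl
step-rule on    false false false = refl
step-rule off   true  true  true  = refl
step-rule off   true  true  false = refl
step-rule off   true  false true  = refl
step-rule off   true  false false = refl
step-rule off   false true  true  = refl
step-rule off   false true  false = refl
step-rule off   false false true  = refl
step-rule off   false false false = refl

localF-interior : ∀ {n} (cs : Vec Cell n) (z : Config n) (i : Fin n) {a} → toℕ i ≡ suc a → suc (suc a) < n →
  localF (network cs) i z ≡ rule (cellAt cs (suc a)) (bit z a) (bit z (suc a)) (bit z (suc (suc a)))
localF-interior cs z i {a} i≡1+a 2+a<n
  rewrite sym (at-toℕ digit cs i) | sym (at-toℕ false z i) | i≡1+a
  = trans (cong (λ s → step (s ℤ.- threshold c) (bit z (suc a))) (input-interior c z 2+a<n))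
          (step-rule c (bit z a) (bit z (suc a)) (bit z (suc (suc a))))
  where c = cellAt cs (suc a)

-- The selector inside updateSet is local to Defs: it is reached by unifying with refl.
lookup-tabulated : ∀ {A : Set} {n} {f : Fin n → A} {xs : Vec A n} → xs ≡ tabulate f → ∀ i → lookup xs i ≡ f i
lookup-tabulated refl i = Vecₚ.lookup∘tabulate _ i

lookup-updateSet-∈ : ∀ {n} (T : ThresholdNetwork n) {I} x {i} → i ∈ I → lookup (updateSet T I x) i ≡ localF T i x
lookup-updateSet-∈ T {I} x {i} i∈I
  rewrite lookup-tabulated {xs = updateSet T I x} refl i | Vecₚ.[]=⇒lookup i∈I = refl

lookup-updateSet-∉ : ∀ {n} (T : ThresholdNetwork n) {I} x {i} → i ∉ I → lookup (updateSet T I x) i ≡ lookup x i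
lookup-updateSet-∉ T {I} x {i} i∉I
  rewrite lookup-tabulated {xs = updateSet T I x} refl i with lookup I i in eq
... | inside  = contradiction (Vecₚ.lookup⇒[]= i I eq) i∉I
... | outside = refl

splice : ∀ {A : Set} {n} → ℕ → Vec A n → Vec A n → Vec A n
splice _       []       []       = []
splice zero    (x ∷ xs) (_ ∷ ys) = x ∷ ys
splice (suc r) (x ∷ xs) (_ ∷ ys) = x ∷ splice r xs ys

at-splice-≤ : ∀ {A : Set} {n} d r (xs ys : Vec A n) {b} → b ≤ r → at d (splice r xs ys) b ≡ at d xs b
at-splice-≤ d _       []       []       _         = refl
at-splice-≤ d zero    (x ∷ xs) (_ ∷ ys) z≤n       = refl
at-splice-≤ d (suc r) (x ∷ xs) (_ ∷ ys) z≤n       = refl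
at-splice-≤ d (suc r) (x ∷ xs) (_ ∷ ys) (s≤s b≤r) = at-splice-≤ d r xs ys b≤r

at-splice-> : ∀ {A : Set} {n} d r (xs ys : Vec A n) {b} → r < b → at d (splice r xs ys) b ≡ at d ys b
at-splice-> d _       []       []       _         = refl
at-splice-> d zero    (x ∷ xs) (_ ∷ ys) (s≤s _)   = refl
at-splice-> d (suc r) (x ∷ xs) (_ ∷ ys) (s≤s r<b) = at-splice-> d r xs ys r<b

splice-≡ˡ : ∀ {A : Set} d r (xs ys : Vec A (suc (suc r))) → at d xs (suc r) ≡ at d ys (suc r) → splice r xs ys ≡ xs
splice-≡ˡ d zero    (x ∷ x′ ∷ []) (_ ∷ y′ ∷ []) x′≡y′ = cong (λ y → x ∷ y ∷ []) (sym x′≡y′)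
splice-≡ˡ d (suc r) (x ∷ xs)      (_ ∷ ys)      eq    = cong (x ∷_) (splice-≡ˡ d r xs ys eq)

sweepRule : ∀ {n} → Bool → Vec Cell n → Config n → Config n
sweepRule l []       []       = []
sweepRule l (c ∷ cs) (x ∷ xs) = rule c l x (bit (sweepRule x cs xs) 0) ∷ sweepRule x cs xs

bit-sweepRule : ∀ {n} l (cs : Vec Cell n) xs a → suc a < n →
  bit (sweepRule l cs xs) (suc a)
    ≡ rule (cellAt cs (suc a)) (bit xs a) (bit xs (suc a)) (bit (sweepRule l cs xs) (suc (suc a)))
bit-sweepRule l (c ∷ c′ ∷ cs) (x ∷ x′ ∷ xs) zero    _         = refl
bit-sweepRule l (c ∷ cs)      (x ∷ xs)      (suc a) (s≤s a<n) = bit-sweepRule x cs xs a a<n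

sweepFrom : ∀ {n} r → .(r < n) → UpdateMode n
sweepFrom zero    _   = []
sweepFrom (suc r) r<n = ⁅ Fin.fromℕ< r<n ⁆ ∷ sweepFrom r (ℕₚ.<-trans (ℕₚ.n<1+n r) r<n)

sweep : (m : ℕ) → UpdateMode (suc (suc m))
sweep m = sweepFrom m (s≤s (ℕₚ.n≤1+n m))

at-splice-suc : ∀ {A : Set} {n} d r (xs ys : Vec A n) {b} → b ≢ suc r →
  at d (splice (suc r) xs ys) b ≡ at d (splice r xs ys) b
at-splice-suc d r xs ys {b} b≢1+r with ℕₚ.<-cmp b (suc r)
... | tri< b<1+r _ _ = trans (at-splice-≤ d (suc r) xs ys (ℕₚ.<⇒≤ b<1+r)) (sym (at-splice-≤ d r xs ys (ℕₚ.≤-pred b<1+r)))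
... | tri≈ _ b≡1+r _ = contradiction b≡1+r b≢1+r
... | tri> _ _ 1+r<b = trans (at-splice-> d (suc r) xs ys 1+r<b) (sym (at-splice-> d r xs ys (ℕₚ.<-trans (ℕₚ.n<1+n r) 1+r<b)))

module _ {m} (cs : Vec Cell (suc (suc m))) (X Y : Config (suc (suc m)))
  (consistent : ∀ a → suc a ≤ m →
     rule (cellAt cs (suc a)) (bit X a) (bit X (suc a)) (bit Y (suc (suc a))) ≡ bit Y (suc a))
  (first : bit X 0 ≡ bit Y 0) (last : bit X (suc m) ≡ bit Y (suc m)) where

  private
    T = network cs

  updateSet-splice : ∀ r .(1+r<n : suc r < suc (suc m)) → suc r ≤ m →
    updateSet T ⁅ Fin.fromℕ< 1+r<n ⁆ (splice (suc r) X Y) ≡ splice r X Y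
  updateSet-splice r 1+r<n 1+r≤m = lookup-ext updated
    where
    i = Fin.fromℕ< 1+r<n
    i≡1+r : toℕ i ≡ suc r
    i≡1+r = Finₚ.toℕ-fromℕ< 1+r<n
    Z = splice (suc r) X Y
    updated : ∀ j → lookup (updateSet T ⁅ i ⁆ Z) j ≡ lookup (splice r X Y) j
    updated j with j Fin.≟ i
    ... | yes refl = begin
        lookup (updateSet T ⁅ i ⁆ Z) i
      ≡⟨ lookup-updateSet-∈ T Z (x∈⁅x⁆ i) ⟩
        localF T i Z
      ≡⟨ localF-interior cs Z i i≡1+r (s≤s (s≤s 1+r≤m)) ⟩
        rule (cellAt cs (suc r)) (bit Z r) (bit Z (suc r)) (bit Z (suc (suc r)))
      ≡⟨ cong₂ (λ u v → rule (cellAt cs (suc r)) u v (bit Z (suc (suc r))))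
           (at-splice-≤ false (suc r) X Y (ℕₚ.n≤1+n r)) (at-splice-≤ false (suc r) X Y ℕₚ.≤-refl) ⟩
        rule (cellAt cs (suc r)) (bit X r) (bit X (suc r)) (bit Z (suc (suc r)))
      ≡⟨ cong (rule (cellAt cs (suc r)) (bit X r) (bit X (suc r))) (at-splice-> false (suc r) X Y ℕₚ.≤-refl) ⟩
        rule (cellAt cs (suc r)) (bit X r) (bit X (suc r)) (bit Y (suc (suc r)))
      ≡⟨ consistent r 1+r≤m ⟩
        bit Y (suc r)
      ≡⟨ sym (at-splice-> false r X Y ℕₚ.≤-refl) ⟩
        bit (splice r X Y) (suc r)
      ≡⟨ cong (bit (splice r X Y)) (sym i≡1+r) ⟩
        bit (splice r X Y) (toℕ i)
      ≡⟨ at-toℕ false (splice r X Y) i ⟩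
        lookup (splice r X Y) i ∎
      where open ≡-Reasoning
    ... | no j≢i = begin
        lookup (updateSet T ⁅ i ⁆ Z) j
      ≡⟨ lookup-updateSet-∉ T Z (x≢y⇒x∉⁅y⁆ j≢i) ⟩
        lookup Z j
      ≡⟨ sym (at-toℕ false Z j) ⟩
        bit Z (toℕ j)
      ≡⟨ at-splice-suc false r X Y (j≢i ∘ Finₚ.toℕ-injective ∘ (λ e → trans e (sym i≡1+r))) ⟩
        bit (splice r X Y) (toℕ j)
      ≡⟨ at-toℕ false (splice r X Y) j ⟩
        lookup (splice r X Y) j ∎
      where open ≡-Reasoning

  globalMap-sweepFrom : ∀ r .(r<n : r < suc (suc m)) → r ≤ m → globalMap T (sweepFrom r r<n) (splice r X Y) ≡ Y
  globalMap-sweepFrom zero    _   _   = splice-zero X Y first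
    where
    splice-zero : ∀ {k} (xs ys : Config (suc k)) → bit xs 0 ≡ bit ys 0 → splice 0 xs ys ≡ ys
    splice-zero (x ∷ xs) (y ∷ ys) x≡y = cong (_∷ ys) x≡y
  globalMap-sweepFrom (suc r) r<n r≤m =
    trans (cong (globalMap T (sweepFrom r _)) (updateSet-splice r r<n r≤m))
          (globalMap-sweepFrom r _ (ℕₚ.<⇒≤ r≤m))

  globalMap-sweep : globalMap T (sweep m) X ≡ Y
  globalMap-sweep = subst (λ Z → globalMap T (sweep m) Z ≡ Y) (splice-≡ˡ false m X Y last)
                          (globalMap-sweepFrom m _ ℕₚ.≤-refl)

-- c ones followed by zeros; the last entry belongs to the off cell, so only c ≤ L is meaningful.
counter : (L c : ℕ) → Vec Bool (suc L)
counter L       zero    = replicate (suc L) false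
counter zero    (suc c) = false ∷ []
counter (suc L) (suc c) = true ∷ counter L c

digits : (L : ℕ) → Vec Cell (suc L)
digits zero    = off ∷ []
digits (suc L) = digit ∷ digits L

size : List ℕ → ℕ
size []       = 0
size (L ∷ Ls) = suc (suc L ℕ.+ size Ls)

cells : (Ls : List ℕ) → Vec Cell (size Ls)
cells []       = []
cells (L ∷ Ls) = on ∷ (digits L ++ cells Ls)

state : (Ls : List ℕ) → ℕ → Config (size Ls)
state []       q = []
state (L ∷ Ls) q = true ∷ (counter L (q % suc L) ++ state Ls q)

suc-% : ∀ q L → suc q % suc L ≡ suc (q % suc L) % suc L
suc-% q L = begin
    suc q % d
  ≡⟨ %-distribˡ-+ 1 q d ⟩
    (1 % d ℕ.+ q % d) % d
  ≡⟨ cong (λ x → (1 % d ℕ.+ x) % d) (sym (m%n%n≡m%n q d)) ⟩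
    (1 % d ℕ.+ q % d % d) % d
  ≡⟨ sym (%-distribˡ-+ 1 (q % d) d) ⟩
    suc (q % d) % d ∎
  where
  open ≡-Reasoning
  d = suc L

module _ {k} {ks : Vec Cell k} {xs : Config k} where

  sweepRule-counter-zero : ∀ L → sweepRule false (digits L ++ ks) (counter L 0 ++ xs) ≡ counter L 0 ++ sweepRule false ks xs
  sweepRule-counter-zero zero    = refl
  sweepRule-counter-zero (suc L) rewrite sweepRule-counter-zero L = refl

  sweepRule-counter-inc : ∀ L c → c < L →
    sweepRule true (digits L ++ ks) (counter L c ++ xs) ≡ counter L (suc c) ++ sweepRule false ks xs
  sweepRule-counter-inc (suc L)       zero    _         rewrite sweepRule-counter-zero L = refl
  sweepRule-counter-inc (suc (suc L)) (suc c) (s≤s c<L) rewrite sweepRule-counter-inc (suc L) c c<L = refl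

  sweepRule-counter-wrap : ∀ L → sweepRule true (digits L ++ ks) (counter L L ++ xs) ≡ counter L 0 ++ sweepRule false ks xs
  sweepRule-counter-wrap zero    = refl
  sweepRule-counter-wrap (suc L) rewrite sweepRule-counter-wrap L = refl

  sweepRule-counter : ∀ L q →
    sweepRule true (digits L ++ ks) (counter L (q % suc L) ++ xs) ≡ counter L (suc q % suc L) ++ sweepRule false ks xs
  sweepRule-counter L q with ℕₚ.m≤n⇒m<n∨m≡n (ℕₚ.≤-pred (m%n<n q (suc L)))
  ... | inj₁ c<L rewrite suc-% q L | m≤n⇒m%n≡m c<L = sweepRule-counter-inc L _ c<L
  ... | inj₂ c≡L rewrite suc-% q L | c≡L | n%n≡0 (suc L) ⦃ _ ⦄ = sweepRule-counter-wrap L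

sweepRule-state : ∀ Ls q {l} → sweepRule l (cells Ls) (state Ls q) ≡ state Ls (suc q)
sweepRule-state []       q = refl
sweepRule-state (L ∷ Ls) q =
  cong (true ∷_) (trans (sweepRule-counter L q) (cong (counter L (suc q % suc L) ++_) (sweepRule-state Ls q)))

cellAt-digits-end : ∀ L {k} (ks : Vec Cell k) j → cellAt (digits L ++ ks) (L ℕ.+ j) ≡ cellAt (off ∷ ks) j
cellAt-digits-end zero    ks j = refl
cellAt-digits-end (suc L) ks j = cellAt-digits-end L ks j

bit-counter-end : ∀ L c {k} (xs : Config k) j → bit (counter L c ++ xs) (L ℕ.+ j) ≡ bit (false ∷ xs) j
bit-counter-end zero    zero    xs j = refl
bit-counter-end zero    (suc c) xs j = refl
bit-counter-end (suc L) zero    xs j = bit-counter-end L zero xs j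
bit-counter-end (suc L) (suc c) xs j = bit-counter-end L c xs j

cellAt-cells-end : ∀ Ls → cellAt (off ∷ cells Ls) (size Ls) ≡ off
cellAt-cells-end []       = refl
cellAt-cells-end (L ∷ Ls) = trans (cellAt-digits-end L (cells Ls) (size Ls)) (cellAt-cells-end Ls)

bit-state-end : ∀ Ls q → bit (false ∷ state Ls q) (size Ls) ≡ false
bit-state-end []       q = refl
bit-state-end (L ∷ Ls) q = trans (bit-counter-end L (q % suc L) (state Ls q) (size Ls)) (bit-state-end Ls q)

blockMap : ∀ L Ls → Config (size (L ∷ Ls)) → Config (size (L ∷ Ls))
blockMap L Ls = globalMap (network (cells (L ∷ Ls))) (sweep (L ℕ.+ size Ls))

blockMap-state : ∀ L Ls q → blockMap L Ls (state (L ∷ Ls) q) ≡ state (L ∷ Ls) (suc q)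
blockMap-state L Ls q = trans (globalMap-sweep cs X Y consistent refl last) (sweepRule-state (L ∷ Ls) q {false})
  where
  m  = L ℕ.+ size Ls
  cs = cells (L ∷ Ls)
  X  = state (L ∷ Ls) q
  Y  = sweepRule false cs X
  consistent : ∀ a → suc a ≤ m → rule (cellAt cs (suc a)) (bit X a) (bit X (suc a)) (bit Y (suc (suc a))) ≡ bit Y (suc a)
  consistent a 1+a≤m = sym (bit-sweepRule false cs X a (s≤s (ℕₚ.m≤n⇒m≤1+n 1+a≤m)))
  last : bit X (suc m) ≡ bit Y (suc m)
  last = begin
      bit X (suc m)
    ≡⟨ trans (bit-counter-end L (q % suc L) (state Ls q) (size Ls)) (bit-state-end Ls q) ⟩
      false
    ≡⟨ cong (λ c → rule c (bit X m) (bit X (suc m)) (bit Y (suc (suc m))))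
         (sym (trans (cellAt-digits-end L (cells Ls) (size Ls)) (cellAt-cells-end Ls))) ⟩
      rule (cellAt cs (suc m)) (bit X m) (bit X (suc m)) (bit Y (suc (suc m)))
    ≡⟨ sym (bit-sweepRule false cs X m ℕₚ.≤-refl) ⟩
      bit Y (suc m) ∎
    where open ≡-Reasoning

iterate-blockMap : ∀ L Ls q → iterate (blockMap L Ls) q (state (L ∷ Ls) 0) ≡ state (L ∷ Ls) q
iterate-blockMap L Ls zero    = refl
iterate-blockMap L Ls (suc q) = trans (cong (blockMap L Ls) (iterate-blockMap L Ls q)) (blockMap-state L Ls q)

counter-≡0 : ∀ L c → c ≤ L → counter L c ≡ counter L 0 → c ≡ 0
counter-≡0 L       zero    _ _ = refl
counter-≡0 (suc L) (suc c) _ ()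

state≡⇒∣ : ∀ Ls q → state Ls q ≡ state Ls 0 → All (λ L → suc L ∣ q) Ls
state≡⇒∣ []       q _ = []
state≡⇒∣ (L ∷ Ls) q eq with Vecₚ.++-injective (counter L (q % suc L)) (counter L 0) (Vecₚ.∷-injectiveʳ eq)
... | counters , rest =
  m%n≡0⇒n∣m q (suc L) (counter-≡0 L _ (ℕₚ.≤-pred (m%n<n q (suc L))) counters) ∷ state≡⇒∣ Ls q rest

∣⇒state≡ : ∀ Ls q → All (λ L → suc L ∣ q) Ls → state Ls q ≡ state Ls 0
∣⇒state≡ []       q []       = refl
∣⇒state≡ (L ∷ Ls) q (d ∷ ds) =
  cong₂ (λ c xs → true ∷ (counter L c ++ xs)) (n∣m⇒m%n≡0 q (suc L) d) (∣⇒state≡ Ls q ds)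

lcm* : List ℕ → ℕ
lcm* = List.foldr lcm 1

lcm*-least : ∀ {q} ms → All (_∣ q) ms → lcm* ms ∣ q
lcm*-least []       []          = 1∣ _
lcm*-least (m ∷ ms) (m∣q ∷ ms∣q) = lcm-least m∣q (lcm*-least ms ms∣q)

∣lcm* : ∀ ms → All (_∣ lcm* ms) ms
∣lcm* []       = []
∣lcm* (m ∷ ms) = m∣lcm[m,n] m _ ∷ All.map (λ d → ∣-trans d (n∣lcm[m,n] m _)) (∣lcm* ms)

lcm-pos : ∀ {m n} → 1 ≤ m → 1 ≤ n → 1 ≤ lcm m n
lcm-pos {m} {n} 1≤m 1≤n = ℕₚ.n≢0⇒n>0 λ lcm≡0 → ℕₚ.<⇒≢ (ℕₚ.*-mono-≤ 1≤m 1≤n) (sym (begin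
    m ℕ.* n             ≡⟨ sym (gcd*lcm m n) ⟩
    gcd m n ℕ.* lcm m n ≡⟨ cong (gcd m n ℕ.*_) lcm≡0 ⟩
    gcd m n ℕ.* 0       ≡⟨ ℕₚ.*-zeroʳ (gcd m n) ⟩
    0                   ∎))
  where open ≡-Reasoning

lcm*-pos : ∀ Ls → 1 ≤ lcm* (List.map suc Ls)
lcm*-pos []       = ℕₚ.≤-refl
lcm*-pos (L ∷ Ls) = lcm-pos (s≤s z≤n) (lcm*-pos Ls)

isAttractorOfPeriod-∣ : ∀ {A : Set} (F : A → A) x {p} → 1 ≤ p → iterate F p x ≡ x →
  (∀ q → iterate F q x ≡ x → p ∣ q) → IsAttractorOfPeriod F x p
isAttractorOfPeriod-∣ F x 1≤p Fᵖx≡x returns⇒∣ = 1≤p , Fᵖx≡x ,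
  λ q 1≤q q<p Fᵠx≡x → ℕₚ.<⇒≱ q<p (∣⇒≤ ⦃ ℕ.>-nonZero 1≤q ⦄ (returns⇒∣ q Fᵠx≡x))

state-isAttractor : ∀ L Ls → IsAttractorOfPeriod (blockMap L Ls) (state (L ∷ Ls) 0) (lcm* (List.map suc (L ∷ Ls)))
state-isAttractor L Ls = isAttractorOfPeriod-∣ (blockMap L Ls) _ (lcm*-pos (L ∷ Ls)) returns returns⇒∣
  where
  ms = List.map suc (L ∷ Ls)
  returns : iterate (blockMap L Ls) (lcm* ms) (state (L ∷ Ls) 0) ≡ state (L ∷ Ls) 0
  returns = trans (iterate-blockMap L Ls (lcm* ms)) (∣⇒state≡ (L ∷ Ls) (lcm* ms) (Allₚ.map⁻ (∣lcm* ms)))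
  returns⇒∣ : ∀ q → iterate (blockMap L Ls) q (state (L ∷ Ls) 0) ≡ state (L ∷ Ls) 0 → lcm* ms ∣ q
  returns⇒∣ q eq = lcm*-least ms (Allₚ.map⁺ (state≡⇒∣ (L ∷ Ls) q (trans (sym (iterate-blockMap L Ls q)) eq)))

∣-difference : ∀ {d} i e M → d ∣ suc (i ℕ.* M) → d ∣ suc ((i ℕ.+ e) ℕ.* M) → d ∣ e
∣-difference {d} i e M d∣1+iM d∣1+jM = ∣m+n∣m⇒∣n (subst (d ∣_) (identity i e M) (∣n⇒∣m*n (i ℕ.+ e) d∣1+iM))
                                                  (∣n⇒∣m*n i d∣1+jM)
  where
  open +-*-Solver
  identity : ∀ i e M → (i ℕ.+ e) ℕ.* (1 ℕ.+ i ℕ.* M) ≡ i ℕ.* (1 ℕ.+ (i ℕ.+ e) ℕ.* M) ℕ.+ e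
  identity = solve 3 (λ i e M → (i :+ e) :* (con 1 :+ i :* M) := i :* (con 1 :+ (i :+ e) :* M) :+ e) refl

-- Any common divisor of 1 + iM and 1 + jM divides j - i ≤ k, hence M, hence 1.
coprime-1+jM : ∀ {k M} → (∀ d → 1 ≤ d → d ≤ k → d ∣ M) →
  ∀ {i j} → i < j → j ≤ k → Coprime (suc (j ℕ.* M)) (suc (i ℕ.* M))
coprime-1+jM {k} {M} divM {i} {j} i<j j≤k {d} (d∣1+jM , d∣1+iM) = ∣1⇒≡1 d∣1
  where
  e = j ℕ.∸ i
  1≤e : 1 ≤ e
  1≤e = ℕₚ.m<n⇒0<n∸m i<j
  d∣e : d ∣ e
  d∣e = ∣-difference i e M d∣1+iM (subst (λ x → d ∣ suc (x ℕ.* M)) (sym (ℕₚ.m+[n∸m]≡n (ℕₚ.<⇒≤ i<j))) d∣1+jM)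
  1≤d : 1 ≤ d
  1≤d = ℕₚ.n≢0⇒n>0 λ { refl → ℕₚ.<⇒≢ 1≤e (sym (0∣⇒≡0 d∣e)) }
  d≤k : d ≤ k
  d≤k = ℕₚ.≤-trans (∣⇒≤ ⦃ ℕ.>-nonZero 1≤e ⦄ d∣e) (ℕₚ.≤-trans (ℕₚ.m∸n≤m j i) j≤k)
  d∣1 : d ∣ 1
  d∣1 = ∣m+n∣m⇒∣n (subst (d ∣_) (ℕₚ.+-comm 1 (i ℕ.* M)) d∣1+iM) (∣n⇒∣m*n i (divM d 1≤d d≤k))

multiples : ℕ → ℕ → List ℕ
multiples M zero    = []
multiples M (suc k) = suc k ℕ.* M ∷ multiples M k

multiples-coprime : ∀ {M} k → (∀ d → 1 ≤ d → d ≤ k → d ∣ M) → AllPairs Coprime (List.map suc (multiples M k))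
multiples-coprime     zero    divM = []
multiples-coprime {M} (suc k) divM =
  coprime-below k ℕₚ.≤-refl ∷ multiples-coprime k (λ d 1≤d d≤k → divM d 1≤d (ℕₚ.m≤n⇒m≤1+n d≤k))
  where
  coprime-below : ∀ i → i ≤ k → All (Coprime (suc (suc k ℕ.* M))) (List.map suc (multiples M i))
  coprime-below zero    _     = []
  coprime-below (suc i) 1+i≤k = coprime-1+jM divM (s≤s 1+i≤k) ℕₚ.≤-refl ∷ coprime-below i (ℕₚ.<⇒≤ 1+i≤k)

∣! : ∀ k d → 1 ≤ d → d ≤ k → d ∣ k !
∣! k (suc d) _ d≤k = ∣-trans (m∣m*n (d !)) (m≤n⇒m!∣n! d≤k)

coprime-* : ∀ {a b c} → Coprime a b → Coprime a c → Coprime a (b ℕ.* c)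
coprime-* {a} cab cac (d∣a , d∣bc) = cac (d∣a , coprime-divisor (λ (e∣d , e∣b) → cab (∣-trans e∣d d∣a , e∣b)) d∣bc)

coprime-product : ∀ {a} ns → All (Coprime a) ns → Coprime a (product ns)
coprime-product []       []       = ∣1⇒≡1 ∘ proj₂
coprime-product (n ∷ ns) (c ∷ cs) = coprime-* c (coprime-product ns cs)

lcm-coprime : ∀ {m n} → Coprime m n → lcm m n ≡ m ℕ.* n
lcm-coprime {m} {n} c = begin
    lcm m n             ≡⟨ sym (ℕₚ.*-identityˡ (lcm m n)) ⟩
    1 ℕ.* lcm m n       ≡⟨ cong (ℕ._* lcm m n) (sym (coprime⇒gcd≡1 c)) ⟩
    gcd m n ℕ.* lcm m n ≡⟨ gcd*lcm m n ⟩
    m ℕ.* n             ∎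
  where open ≡-Reasoning

lcm*-coprime : ∀ ms → AllPairs Coprime ms → lcm* ms ≡ product ms
lcm*-coprime []       []       = refl
lcm*-coprime (m ∷ ms) (c ∷ cs) = trans (cong (lcm m) (lcm*-coprime ms cs)) (lcm-coprime (coprime-product ms c))

^≤product-multiples : ∀ M k → suc M ^ k ≤ product (List.map suc (multiples M k))
^≤product-multiples M zero    = ℕₚ.≤-refl
^≤product-multiples M (suc k) = ℕₚ.*-mono-≤ (s≤s (ℕₚ.m≤m+n M (k ℕ.* M))) (^≤product-multiples M k)

size-multiples : ∀ M k → size (multiples M k) ≤ k ℕ.* (2 ℕ.+ k ℕ.* M)
size-multiples M zero    = z≤n
size-multiples M (suc k) = begin
    2 ℕ.+ (suc k ℕ.* M ℕ.+ size (multiples M k))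
  ≤⟨ ℕₚ.+-monoʳ-≤ 2 (ℕₚ.+-monoʳ-≤ (suc k ℕ.* M) (size-multiples M k)) ⟩
    2 ℕ.+ (suc k ℕ.* M ℕ.+ k ℕ.* (2 ℕ.+ k ℕ.* M))
  ≤⟨ ℕₚ.+-monoʳ-≤ 2 (ℕₚ.+-monoʳ-≤ (suc k ℕ.* M)
       (ℕₚ.*-monoʳ-≤ k (ℕₚ.+-monoʳ-≤ 2 (ℕₚ.*-monoˡ-≤ M (ℕₚ.n≤1+n k))))) ⟩
    2 ℕ.+ (suc k ℕ.* M ℕ.+ k ℕ.* (2 ℕ.+ suc k ℕ.* M))
  ≡⟨ solve 2 (λ k M → con 2 :+ ((con 1 :+ k) :* M :+ k :* (con 2 :+ (con 1 :+ k) :* M))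
                 := (con 1 :+ k) :* (con 2 :+ (con 1 :+ k) :* M)) refl k M ⟩
    suc k ℕ.* (2 ℕ.+ suc k ℕ.* M) ∎
  where
  open ℕₚ.≤-Reasoning
  open +-*-Solver

size-multiples-cube : ∀ M k → k ≤ M → suc (size (multiples M k)) ≤ suc M ^ 3
size-multiples-cube M k k≤M = begin
    suc (size (multiples M k))
  ≤⟨ s≤s (size-multiples M k) ⟩
    suc (k ℕ.* (2 ℕ.+ k ℕ.* M))
  ≤⟨ s≤s (ℕₚ.*-mono-≤ k≤M (ℕₚ.+-monoʳ-≤ 2 (ℕₚ.*-monoˡ-≤ M k≤M))) ⟩
    suc (M ℕ.* (2 ℕ.+ M ℕ.* M))
  ≤⟨ ℕₚ.m≤m+n _ (3 ℕ.* M ℕ.* M ℕ.+ M) ⟩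
    suc (M ℕ.* (2 ℕ.+ M ℕ.* M)) ℕ.+ (3 ℕ.* M ℕ.* M ℕ.+ M)
  ≡⟨ solve 1 (λ M → (con 1 :+ M :* (con 2 :+ M :* M)) :+ (con 3 :* M :* M :+ M) := (con 1 :+ M) :^ 3) refl M ⟩
    suc M ^ 3 ∎
  where
  open ℕₚ.≤-Reasoning
  open +-*-Solver

size-multiples-monoˡ : ∀ {M M′} k → M ≤ M′ → size (multiples M k) ≤ size (multiples M′ k)
size-multiples-monoˡ zero    _    = z≤n
size-multiples-monoˡ (suc k) M≤M′ = s≤s (s≤s (ℕₚ.+-mono-≤ (ℕₚ.*-monoʳ-≤ (suc k) M≤M′) (size-multiples-monoˡ k M≤M′)))

‖_‖ : Poly → ℕ
‖ []     ‖ = 0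
‖ c ∷ cs ‖ = ℤ.∣ c ∣ ℕ.+ ‖ cs ‖

∣evalPoly∣≤ : ∀ q n → ℤ.∣ evalPoly q (+ n) ∣ ≤ ‖ q ‖ ℕ.* suc n ^ List.length q
∣evalPoly∣≤ []       n = z≤n
∣evalPoly∣≤ (c ∷ cs) n = begin
    ℤ.∣ c ℤ.+ + n ℤ.* evalPoly cs (+ n) ∣
  ≤⟨ ℤₚ.∣i+j∣≤∣i∣+∣j∣ c _ ⟩
    ℤ.∣ c ∣ ℕ.+ ℤ.∣ + n ℤ.* evalPoly cs (+ n) ∣
  ≡⟨ cong (ℤ.∣ c ∣ ℕ.+_) (ℤₚ.abs-* (+ n) (evalPoly cs (+ n))) ⟩
    ℤ.∣ c ∣ ℕ.+ n ℕ.* ℤ.∣ evalPoly cs (+ n) ∣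
  ≤⟨ ℕₚ.+-mono-≤ (ℕₚ.m≤m*n ℤ.∣ c ∣ (suc n ℕ.* D) ⦃ ℕₚ.m^n≢0 (suc n) (suc (List.length cs)) ⦄)
                  (ℕₚ.*-mono-≤ (ℕₚ.n≤1+n n) (∣evalPoly∣≤ cs n)) ⟩
    ℤ.∣ c ∣ ℕ.* (suc n ℕ.* D) ℕ.+ suc n ℕ.* (‖ cs ‖ ℕ.* D)
  ≡⟨ cong (ℤ.∣ c ∣ ℕ.* (suc n ℕ.* D) ℕ.+_) (solve 3 (λ s B D → s :* (B :* D) := B :* (s :* D)) refl (suc n) ‖ cs ‖ D) ⟩
    ℤ.∣ c ∣ ℕ.* (suc n ℕ.* D) ℕ.+ ‖ cs ‖ ℕ.* (suc n ℕ.* D)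
  ≡⟨ sym (ℕₚ.*-distribʳ-+ (suc n ℕ.* D) ℤ.∣ c ∣ ‖ cs ‖) ⟩
    (ℤ.∣ c ∣ ℕ.+ ‖ cs ‖) ℕ.* (suc n ℕ.* D) ∎
  where
  open ℕₚ.≤-Reasoning
  open +-*-Solver
  D = suc n ^ List.length cs

i≤+∣i∣ : ∀ i → i ℤ.≤ + ℤ.∣ i ∣
i≤+∣i∣ (+ n)    = ℤₚ.≤-refl
i≤+∣i∣ -[1+ n ] = ℤ.-≤+

module StrictlyIncreasing {f : ℕ → ℕ} (f-suc : ∀ t → f t < f (suc t)) where

  mono-< : ∀ {t u} → t < u → f t < f u
  mono-< {t} {suc u} (s≤s t≤u) with ℕₚ.m≤n⇒m<n∨m≡n t≤u
  ... | inj₁ t<u  = ℕₚ.<-trans (mono-< t<u) (f-suc u)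
  ... | inj₂ refl = f-suc t

  cancel-≤ : ∀ {t u} → f t ≤ f u → t ≤ u
  cancel-≤ ft≤fu = ℕₚ.≮⇒≥ (λ u<t → ℕₚ.<⇒≱ (mono-< u<t) ft≤fu)

  injective : ∀ {t u} → f t ≡ f u → t ≡ u
  injective eq = ℕₚ.≤-antisym (cancel-≤ (ℕₚ.≤-reflexive eq)) (cancel-≤ (ℕₚ.≤-reflexive (sym eq)))

  ≤-self : ∀ t → t ≤ f t
  ≤-self zero    = z≤n
  ≤-self (suc t) = ℕₚ.≤-<-trans (≤-self t) (f-suc t)

search : (ℕ → ℕ) → ℕ → ℕ → ℕ
search f n zero    = zero
search f n (suc u) with f (suc u) ℕₚ.≟ n
... | yes _ = suc u
... | no  _ = search f n u

search-inverse : ∀ {f} → (∀ {s t} → f s ≡ f t → s ≡ t) → ∀ {t u} → t ≤ u → search f (f t) u ≡ t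
search-inverse             injective {u = zero}  z≤n = refl
search-inverse {f} injective {t} {suc u} t≤1+u with f (suc u) ℕₚ.≟ f t
... | yes eq = injective eq
... | no ne with ℕₚ.m≤n⇒m<n∨m≡n t≤1+u
...   | inj₁ t<1+u = search-inverse injective (ℕₚ.≤-pred t<1+u)
...   | inj₂ refl  = contradiction refl ne

blockLengths : ℕ → List ℕ
blockLengths t = multiples (suc t !) (suc t)

order : ℕ → ℕ
order t = size (blockLengths t)

period : ℕ → ℕ
period t = lcm* (List.map suc (blockLengths t))

order-suc : ∀ t → order t < order (suc t)
order-suc t = s≤s (ℕₚ.≤-trans (size-multiples-monoˡ (suc t) (ℕₚ.m≤n*m (suc t !) (suc (suc t))))
                               (ℕₚ.≤-trans (ℕₚ.m≤n+m _ _) (ℕₚ.n≤1+n _)))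

open StrictlyIncreasing order-suc using () renaming (cancel-≤ to order-cancel-≤; injective to order-injective; ≤-self to ≤-order)

CycleAttractor : (n p : ℕ) → Set
CycleAttractor n p = Σ[ T ∈ ThresholdNetwork n ] (IsSignedCycleWithLoops n (W T) ×
  Σ[ μ ∈ UpdateMode n ] Σ[ x ∈ Config n ] IsAttractorOfPeriod (globalMap T μ) x p)

realisation : ∀ t → CycleAttractor (order t) (period t)
realisation t = network (cells Ls) , network-isSignedCycle (cells Ls) 3≤order ,
                sweep (L ℕ.+ size Ls′) , state Ls 0 , state-isAttractor L Ls′
  where
  L = suc t ℕ.* suc t !
  Ls′ = multiples (suc t !) t
  Ls = L ∷ Ls′
  3≤order : 3 ≤ order t
  3≤order = s≤s (s≤s (ℕₚ.≤-trans (ℕₚ.1≤n! (suc t))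
                       (ℕₚ.≤-trans (ℕₚ.m≤m+n (suc t !) (t ℕ.* suc t !)) (ℕₚ.m≤m+n _ _))))

^≤period : ∀ t → suc (suc t !) ^ suc t ≤ period t
^≤period t = subst (suc (suc t !) ^ suc t ≤_)
                   (sym (lcm*-coprime (List.map suc (blockLengths t)) (multiples-coprime (suc t) (∣! (suc t)))))
                   (^≤product-multiples (suc t !) (suc t))

order<^ : ∀ t → suc (order t) ≤ suc (suc t !) ^ 3
order<^ t = size-multiples-cube (suc t !) (suc t) (ℕₚ.m≤m*n (suc t) (t !) ⦃ ℕ.>-nonZero (ℕₚ.1≤n! t) ⦄)

period-dominates : ∀ q t → ‖ q ‖ ℕ.+ 3 ℕ.* List.length q ≤ t → ‖ q ‖ ℕ.* suc (order t) ^ List.length q < period t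
period-dominates q t A+3d≤t = begin-strict
    A ℕ.* suc (order t) ^ d
  ≤⟨ ℕₚ.*-monoʳ-≤ A (ℕₚ.^-monoˡ-≤ d (order<^ t)) ⟩
    A ℕ.* (suc M ^ 3) ^ d
  ≡⟨ cong (A ℕ.*_) (ℕₚ.^-*-assoc (suc M) 3 d) ⟩
    A ℕ.* suc M ^ (3 ℕ.* d)
  <⟨ ℕₚ.*-monoˡ-< (suc M ^ (3 ℕ.* d)) ⦃ ℕₚ.m^n≢0 (suc M) (3 ℕ.* d) ⦄ A<1+M ⟩
    suc M ^ suc (3 ℕ.* d)
  ≤⟨ ℕₚ.^-monoʳ-≤ (suc M) (s≤s (ℕₚ.≤-trans (ℕₚ.m≤n+m (3 ℕ.* d) A) A+3d≤t)) ⟩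
    suc M ^ suc t
  ≤⟨ ^≤period t ⟩
    period t ∎
  where
  open ℕₚ.≤-Reasoning
  A = ‖ q ‖
  d = List.length q
  M = suc t !
  A<1+M : A < suc M
  A<1+M = s≤s (ℕₚ.≤-trans (ℕₚ.≤-trans (ℕₚ.m≤m+n A (3 ℕ.* d)) A+3d≤t)
                          (ℕₚ.≤-trans (ℕₚ.n≤1+n t) (ℕₚ.m≤m*n (suc t) (t !) ⦃ ℕ.>-nonZero (ℕₚ.1≤n! t) ⦄)))

evalPoly<period : ∀ q t → ‖ q ‖ ℕ.+ 3 ℕ.* List.length q ≤ t → evalPoly q (+ order t) ℤ.< + period t
evalPoly<period q t A+3d≤t = begin-strict
    evalPoly q (+ order t)
  ≤⟨ i≤+∣i∣ _ ⟩
    + ℤ.∣ evalPoly q (+ order t) ∣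
  ≤⟨ ℤ.+≤+ (∣evalPoly∣≤ q (order t)) ⟩
    + (‖ q ‖ ℕ.* suc (order t) ^ List.length q)
  <⟨ ℤ.+<+ (period-dominates q t A+3d≤t) ⟩
    + period t ∎
  where open ℤₚ.≤-Reasoning

theorem6 : Σ[ S ∈ (ℕ → Set) ] Σ[ p ∈ (ℕ → ℕ) ]
    ((∀ m → ∃[ n ] (m ≤ n × S n)) ×
     (∀ n → S n → Σ[ T ∈ ThresholdNetwork n ] (IsSignedCycleWithLoops n (W T) ×
        Σ[ μ ∈ UpdateMode n ] Σ[ x ∈ Config n ] IsAttractorOfPeriod (globalMap T μ) x (p n))) ×
     (∀ (q : Poly) → ∃[ N ] (∀ n → S n → N ≤ n → evalPoly q (+ n) ℤ.< + p n)))
theorem6 = S , p , unbounded , realised , dominated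
  where
  S : ℕ → Set
  S n = Σ[ t ∈ ℕ ] n ≡ order t
  p : ℕ → ℕ
  p n = period (search order n n)
  p-order : ∀ t → p (order t) ≡ period t
  p-order t = cong period (search-inverse {order} order-injective {t} {order t} (≤-order t))
  unbounded : ∀ m → ∃[ n ] (m ≤ n × S n)
  unbounded m = order m , ≤-order m , m , refl
  realised : ∀ n → S n → CycleAttractor n (p n)
  realised .(order t) (t , refl) = subst (CycleAttractor (order t)) (sym (p-order t)) (realisation t)
  dominated : ∀ q → ∃[ N ] (∀ n → S n → N ≤ n → evalPoly q (+ n) ℤ.< + p n)
  dominated q = order (‖ q ‖ ℕ.+ 3 ℕ.* List.length q) , λ where
    .(order t) (t , refl) N≤n →
      subst (λ P → evalPoly q (+ order t) ℤ.< + P) (sym (p-order t)) (evalPoly<period q t (order-cancel-≤ N≤n))
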